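{- Let $M$ be a matroid and $S$ a set of clones of $M$. If $S$ is a circuit of $M$, then there is a unique (up to isomorphism) clone extension of $M$ over $S$.
   Context: Two elements $e,f$ of a matroid $M$ are clones if the transposition of $e$ and $f$ (fixing all other elements) is an automorphism of $M$. A set $S$ of elements is a set of clones if every two elements of $S$ are clones. A clone extension of $M$ over $S$ is a single-element extension $M+f$ of $M$ such that $S\cup\{f\}$ is a set of clones of $M+f$. -}

module Defs where

open import Data.Nat using (ℕ; suc; _<_)
open import Data.Bool using (Bool; true; false)
open import Data.Fin using (Fin; zero; suc)
open import Data.Fin.Subset using (Subset; ⊥; _∈_; _∉_; _⊆_; _∪_; _-_; ⁅_⁆; ∣_∣)
open import Data.Fin.Permutation using (Permutation′; _⟨$⟩ʳ_; _⟨$⟩ˡ_; transpose)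
open import Data.Vec using (_∷_; lookup; tabulate)
open import Data.Product using (Σ; ∃; _×_; _,_)
open import Relation.Nullary using (¬_; Dec)
open import Relation.Binary.PropositionalEquality using (_≡_)
open import Function.Bundles using (_⇔_)

record Matroid (n : ℕ) : Set₁ where
  field
    Indep        : Subset n → Set
    indep?       : (A : Subset n) → Dec (Indep A)
    indep-empty  : Indep ⊥
    indep-subset : ∀ {A B} → A ⊆ B → Indep B → Indep A
    indep-aug    : ∀ {A B} → Indep A → Indep B → ∣ A ∣ < ∣ B ∣ →
                   ∃ λ x → x ∈ B × x ∉ A × Indep (A ∪ ⁅ x ⁆)
open Matroid public

-- image of a subset under a permutation of the ground set: i ∈ A iff π i ∈ image π A
image : ∀ {n} → Permutation′ n → Subset n → Subset n
image π A = tabulate (λ j → lookup A (π ⟨$⟩ˡ j))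

IsIsomorphism : ∀ {n} → Matroid n → Matroid n → Permutation′ n → Set
IsIsomorphism M N π = ∀ A → Indep M A ⇔ Indep N (image π A)

IsAutomorphism : ∀ {n} → Matroid n → Permutation′ n → Set
IsAutomorphism M π = IsIsomorphism M M π

Clones : ∀ {n} → Matroid n → Fin n → Fin n → Set
Clones M e f = IsAutomorphism M (transpose e f)

CloneSet : ∀ {n} → Matroid n → Subset n → Set
CloneSet M S = ∀ e f → e ∈ S → f ∈ S → Clones M e f

Circuit : ∀ {n} → Matroid n → Subset n → Set
Circuit M C = ¬ Indep M C × (∀ x → x ∈ C → Indep M (C - x))

-- Single-element extensions of M (on Fin n) are matroids on Fin (suc n), where
-- the new element f is `zero` and the element i of M is `suc i`.
-- A subset A of E(M) corresponds to  false ∷ A.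
IsExtension : ∀ {n} → Matroid n → Matroid (suc n) → Set
IsExtension M N = ∀ A → Indep M A ⇔ Indep N (false ∷ A)

-- Clone extension of M over S: a single-element extension M+f with S ∪ {f}
-- (= true ∷ S) a set of clones of M+f.
IsCloneExtension : ∀ {n} → Matroid n → Subset n → Matroid (suc n) → Set
IsCloneExtension M S N = IsExtension M N × CloneSet N (true ∷ S)

ExtIsomorphic : ∀ {n} → Matroid (suc n) → Matroid (suc n) → Set
ExtIsomorphic {n} N N′ =
  Σ (Permutation′ (suc n)) λ π → IsIsomorphism N N′ π × (∀ (i : Fin n) → π ⟨$⟩ʳ suc i ≡ suc i)

-- In a clone extension M + f over S, swapping f with some s ∈ S − A shows that A ∪ {f} is
-- independent exactly when A ∪ {s} is independent for some s ∈ S − A; such an s exists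
-- whenever A ∪ {f} is independent, since A ⊇ S would make the circuit S independent. So the
-- independent sets of every clone extension are determined, and it remains to check that this
-- rule (the principal extension of M on the flat spanned by S) is a matroid in which f is a
-- clone of every element of S; the latter holds because S is a set of clones of M.
module Submission where

open import Data.Bool using (true; false)
open import Data.Fin using (Fin; zero; suc)
open import Data.Fin.Properties using (_≟_; suc-injective; any?)
open import Data.Fin.Permutation as Perm
  using (Permutation′; _⟨$⟩ʳ_; _⟨$⟩ˡ_; transpose; inverseˡ; inverseʳ; lift₀-transpose)
open import Data.Fin.Subset using (Subset; _∈_; _∉_; _⊆_; _∪_; _-_; ⁅_⁆; ∣_∣)
open import Data.Fin.Subset.Properties
open import Data.Nat using (suc; _<_)
open import Data.Nat.Properties using (n<1+n; ≤-pred)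
open import Data.Product using (Σ; ∃; _×_; _,_; proj₁)
open import Data.Sum using (_⊎_; inj₁; inj₂)
open import Data.Vec using (_∷_; lookup; here; there)
open import Data.Vec.Properties using (lookup∘tabulate; tabulate∘lookup; tabulate-cong; []=⇒lookup; lookup⇒[]=)
open import Function using (_∘_)
open import Function.Bundles using (_⇔_; mk⇔; Equivalence)
open import Function.Construct.Composition using (_⇔-∘_)
open import Function.Construct.Identity using (⇔-id)
open import Function.Construct.Symmetry using (⇔-sym)
open import Relation.Nullary using (¬_; Dec; yes; no; ¬?; contradiction)
open import Relation.Nullary.Decidable using (_×-dec_; dec-true; dec-false; decidable-stable)
open import Relation.Binary.PropositionalEquality

open import Defs

transpose-matchˡ : ∀ {n} (i j : Fin n) → transpose i j ⟨$⟩ʳ i ≡ j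
transpose-matchˡ i j rewrite dec-true (i ≟ i) refl = refl

transpose-matchʳ : ∀ {n} (i j : Fin n) → transpose i j ⟨$⟩ʳ j ≡ i
transpose-matchʳ i j with j ≟ i
... | yes j≡i = j≡i
... | no _ rewrite dec-true (j ≟ j) refl = refl

transpose-mismatch : ∀ {n} {i j k : Fin n} → k ≢ i → k ≢ j → transpose i j ⟨$⟩ʳ k ≡ k
transpose-mismatch {i = i} {j} {k} k≢i k≢j rewrite dec-false (k ≟ i) k≢i | dec-false (k ≟ j) k≢j = refl

-- The case splits below are done on auxiliary Dec arguments: a `with k ≟ i` would also
-- abstract the `k ≟ i` hidden inside the definition of transpose in the goal.
transpose-comm : ∀ {n} (i j k : Fin n) → transpose i j ⟨$⟩ʳ k ≡ transpose j i ⟨$⟩ʳ k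
transpose-comm i j k = cases (k ≟ i) (k ≟ j)
  where
  cases : Dec (k ≡ i) → Dec (k ≡ j) → transpose i j ⟨$⟩ʳ k ≡ transpose j i ⟨$⟩ʳ k
  cases (yes refl) _          = trans (transpose-matchˡ k j) (sym (transpose-matchʳ j k))
  cases (no _)     (yes refl) = trans (transpose-matchʳ i k) (sym (transpose-matchˡ k i))
  cases (no k≢i)   (no k≢j)   = trans (transpose-mismatch k≢i k≢j) (sym (transpose-mismatch k≢j k≢i))

transpose-same : ∀ {n} (i k : Fin n) → transpose i i ⟨$⟩ʳ k ≡ k
transpose-same i k = cases (k ≟ i)
  where
  cases : Dec (k ≡ i) → transpose i i ⟨$⟩ʳ k ≡ k
  cases (yes refl) = transpose-matchˡ k k
  cases (no k≢i)   = transpose-mismatch k≢i k≢i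

transpose-involutive : ∀ {n} (i j k : Fin n) → transpose i j ⟨$⟩ʳ (transpose i j ⟨$⟩ʳ k) ≡ k
transpose-involutive i j k = trans (cong (transpose i j ⟨$⟩ʳ_) (transpose-comm i j k)) (inverseʳ (transpose i j))

transpose-∈ : ∀ {n} {S : Subset n} {i j k} → i ∈ S → j ∈ S → k ∈ S → transpose i j ⟨$⟩ʳ k ∈ S
transpose-∈ {S = S} {i} {j} {k} i∈S j∈S k∈S = cases (k ≟ i) (k ≟ j)
  where
  cases : Dec (k ≡ i) → Dec (k ≡ j) → transpose i j ⟨$⟩ʳ k ∈ S
  cases (yes refl) _          = subst (_∈ S) (sym (transpose-matchˡ k j)) j∈S
  cases (no _)     (yes refl) = subst (_∈ S) (sym (transpose-matchʳ i k)) i∈S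
  cases (no k≢i)   (no k≢j)   = subst (_∈ S) (sym (transpose-mismatch k≢i k≢j)) k∈S

module _ {n} {p : Subset n} where

  x∈p∪⁅y⁆⁻ : ∀ {x y} → x ∈ p ∪ ⁅ y ⁆ → x ∈ p ⊎ x ≡ y
  x∈p∪⁅y⁆⁻ {y = y} x∈ with x∈p∪q⁻ p ⁅ y ⁆ x∈
  ... | inj₁ x∈p = inj₁ x∈p
  ... | inj₂ x∈y = inj₂ (x∈⁅y⁆⇒x≡y y x∈y)

  y∈p∪⁅y⁆ : ∀ {y} → y ∈ p ∪ ⁅ y ⁆
  y∈p∪⁅y⁆ {y} = q⊆p∪q p ⁅ y ⁆ (x∈⁅x⁆ y)

  x∈p∪⁅y⁆∧x≢y⇒x∈p : ∀ {x y} → x ∈ p ∪ ⁅ y ⁆ → x ≢ y → x ∈ p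
  x∈p∪⁅y⁆∧x≢y⇒x∈p x∈ x≢y with x∈p∪⁅y⁆⁻ x∈
  ... | inj₁ x∈p = x∈p
  ... | inj₂ x≡y = contradiction x≡y x≢y

  x∉p∪⁅y⁆ : ∀ {x y} → x ∉ p → x ≢ y → x ∉ p ∪ ⁅ y ⁆
  x∉p∪⁅y⁆ x∉p x≢y x∈ = x∉p (x∈p∪⁅y⁆∧x≢y⇒x∈p x∈ x≢y)

  p∪⁅x⁆⊆q : ∀ {q x} → p ⊆ q → x ∈ q → p ∪ ⁅ x ⁆ ⊆ q
  p∪⁅x⁆⊆q p⊆q x∈q y∈ with x∈p∪⁅y⁆⁻ y∈
  ... | inj₁ y∈p  = p⊆q y∈p
  ... | inj₂ refl = x∈q

  p∪⁅x⁆∪⁅y⁆-comm : ∀ x y → (p ∪ ⁅ x ⁆) ∪ ⁅ y ⁆ ≡ (p ∪ ⁅ y ⁆) ∪ ⁅ x ⁆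
  p∪⁅x⁆∪⁅y⁆-comm x y = begin
    (p ∪ ⁅ x ⁆) ∪ ⁅ y ⁆ ≡⟨ ∪-assoc p ⁅ x ⁆ ⁅ y ⁆ ⟩
    p ∪ (⁅ x ⁆ ∪ ⁅ y ⁆) ≡⟨ cong (p ∪_) (∪-comm ⁅ x ⁆ ⁅ y ⁆) ⟩
    p ∪ (⁅ y ⁆ ∪ ⁅ x ⁆) ≡⟨ ∪-assoc p ⁅ y ⁆ ⁅ x ⁆ ⟨
    (p ∪ ⁅ y ⁆) ∪ ⁅ x ⁆ ∎
    where open ≡-Reasoning

x∉p-x : ∀ {n} (p : Subset n) x → x ∉ p - x
x∉p-x (_ ∷ p) zero    ()
x∉p-x (_ ∷ p) (suc x) (there x∈) = x∉p-x p x x∈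

∣p∪⁅x⁆∣≡1+∣p∣ : ∀ {n} {p : Subset n} {x} → x ∉ p → ∣ p ∪ ⁅ x ⁆ ∣ ≡ suc ∣ p ∣
∣p∪⁅x⁆∣≡1+∣p∣ {p = true  ∷ p} {zero}  x∉p = contradiction here x∉p
∣p∪⁅x⁆∣≡1+∣p∣ {p = false ∷ p} {zero}  x∉p = cong (suc ∘ ∣_∣) (∪-identityʳ p)
∣p∪⁅x⁆∣≡1+∣p∣ {p = true  ∷ p} {suc x} x∉p = cong suc (∣p∪⁅x⁆∣≡1+∣p∣ (x∉p ∘ there))
∣p∪⁅x⁆∣≡1+∣p∣ {p = false ∷ p} {suc x} x∉p = ∣p∪⁅x⁆∣≡1+∣p∣ (x∉p ∘ there)

⊈⇒∃∉ : ∀ {n} {p q : Subset n} → ¬ p ⊆ q → ∃ λ x → x ∈ p × x ∉ q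
⊈⇒∃∉ {p = p} {q} p⊈q with any? (λ x → x ∈? p ×-dec ¬? (x ∈? q))
... | yes witness = witness
... | no ∄x = contradiction (λ {x} x∈p → decidable-stable (x ∈? q) λ x∉q → ∄x (x , x∈p , x∉q))
                            p⊈q

module _ {n} (π : Permutation′ n) where

  lookup-image : ∀ A j → lookup (image π A) j ≡ lookup A (π ⟨$⟩ˡ j)
  lookup-image A = lookup∘tabulate (λ j → lookup A (π ⟨$⟩ˡ j))

  ∈-image⁻ : ∀ {A j} → j ∈ image π A → π ⟨$⟩ˡ j ∈ A
  ∈-image⁻ {A} {j} j∈πA = lookup⇒[]= _ A (trans (sym (lookup-image A j)) ([]=⇒lookup j∈πA))

  ∈-image⁺ : ∀ {A i} → i ∈ A → π ⟨$⟩ʳ i ∈ image π A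
  ∈-image⁺ {A} {i} i∈A = lookup⇒[]= _ (image π A) (begin
    lookup (image π A) (π ⟨$⟩ʳ i) ≡⟨ lookup-image A (π ⟨$⟩ʳ i) ⟩
    lookup A (π ⟨$⟩ˡ (π ⟨$⟩ʳ i))  ≡⟨ cong (lookup A) (inverseˡ π) ⟩
    lookup A i                    ≡⟨ []=⇒lookup i∈A ⟩
    true                          ∎)
    where open ≡-Reasoning

  ∉-image⁺ : ∀ {A i} → i ∉ A → π ⟨$⟩ʳ i ∉ image π A
  ∉-image⁺ {A} i∉A πi∈πA = i∉A (subst (_∈ A) (inverseˡ π) (∈-image⁻ πi∈πA))

  image-⊆ : ∀ {A B} → (∀ {i} → i ∈ A → π ⟨$⟩ʳ i ∈ B) → image π A ⊆ B
  image-⊆ {B = B} πA⊆B j∈πA = subst (_∈ B) (inverseʳ π) (πA⊆B (∈-image⁻ j∈πA))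

  image-mono : ∀ {A B} → A ⊆ B → image π A ⊆ image π B
  image-mono A⊆B = image-⊆ (∈-image⁺ ∘ A⊆B)

image-id : ∀ {n} (A : Subset n) → image Perm.id A ≡ A
image-id = tabulate∘lookup

image-transpose-comm : ∀ {n} (i j : Fin n) A → image (transpose j i) A ≡ image (transpose i j) A
image-transpose-comm i j A = tabulate-cong (λ k → cong (lookup A) (transpose-comm i j k))

image-transpose-suc : ∀ {n} (i j : Fin n) x A →
  image (transpose (suc i) (suc j)) (x ∷ A) ≡ x ∷ image (transpose i j) A
image-transpose-suc i j x A =
  cong (x ∷_) (tabulate-cong (λ k → cong (lookup (x ∷ A)) (lift₀-transpose j i (suc k))))

image-transpose-∪⁅⁆-⊆ : ∀ {n} {p : Subset n} {i j} → i ∉ p → j ∉ p →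
  image (transpose i j) (p ∪ ⁅ i ⁆) ⊆ p ∪ ⁅ j ⁆
image-transpose-∪⁅⁆-⊆ {p = p} {i} {j} i∉p j∉p = image-⊆ (transpose i j) maps
  where
  maps : ∀ {k} → k ∈ p ∪ ⁅ i ⁆ → transpose i j ⟨$⟩ʳ k ∈ p ∪ ⁅ j ⁆
  maps {k} k∈ with x∈p∪⁅y⁆⁻ k∈
  ... | inj₂ refl = subst (_∈ p ∪ ⁅ j ⁆) (sym (transpose-matchˡ k j)) y∈p∪⁅y⁆
  ... | inj₁ k∈p  = subst (_∈ p ∪ ⁅ j ⁆)
    (sym (transpose-mismatch (λ { refl → i∉p k∈p }) (λ { refl → j∉p k∈p }))) (p⊆p∪q _ k∈p)

image-transpose₀-⊆ : ∀ {n} (a : Fin n) {X B : Subset (suc n)} →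
  (zero ∈ X → suc a ∈ B) → (suc a ∈ X → zero ∈ B) →
  (∀ {k} → suc k ∈ X → k ≢ a → suc k ∈ B) →
  image (transpose zero (suc a)) X ⊆ B
image-transpose₀-⊆ a {X} {B} new old others = image-⊆ τ maps
  where
  τ = transpose zero (suc a)
  cases : ∀ {k} → suc k ∈ X → Dec (k ≡ a) → τ ⟨$⟩ʳ suc k ∈ B
  cases k∈X (yes refl) = subst (_∈ B) (sym (transpose-matchʳ zero (suc a))) (old k∈X)
  cases k∈X (no k≢a)   =
    subst (_∈ B) (sym (transpose-mismatch {i = zero} (λ ()) (k≢a ∘ suc-injective))) (others k∈X k≢a)
  maps : ∀ {i} → i ∈ X → τ ⟨$⟩ʳ i ∈ B
  maps {zero}  0∈X = subst (_∈ B) (sym (transpose-matchˡ zero (suc a))) (new 0∈X)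
  maps {suc k} k∈X = cases k∈X (k ≟ a)

module _ {n} (M : Matroid n) where

  automorphism-transfer : ∀ π X {Y} → IsAutomorphism M π → image π X ⊆ Y → Indep M Y → Indep M X
  automorphism-transfer π X π-aut πX⊆Y Y-ind = Equivalence.from (π-aut X) (indep-subset M πX⊆Y Y-ind)

  involution⇒automorphism : ∀ π → (∀ k → π ⟨$⟩ʳ (π ⟨$⟩ʳ k) ≡ k) →
    (∀ A → Indep M A → Indep M (image π A)) → IsAutomorphism M π
  involution⇒automorphism π π-invol π-indep A =
    mk⇔ (π-indep A) (indep-subset M A⊆ππA ∘ π-indep (image π A))
    where
    A⊆ππA : A ⊆ image π (image π A)
    A⊆ππA i∈A = subst (_∈ image π (image π A)) (π-invol _) (∈-image⁺ π (∈-image⁺ π i∈A))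

  clones-refl : ∀ e → Clones M e e
  clones-refl e = involution⇒automorphism (transpose e e) (transpose-involutive e e) λ A →
    indep-subset M (image-⊆ (transpose e e) λ {i} i∈A → subst (_∈ A) (sym (transpose-same e i)) i∈A)

  clones-sym : ∀ {e f} → Clones M e f → Clones M f e
  clones-sym {e} {f} ef-clones A =
    subst (λ B → Indep M A ⇔ Indep M B) (sym (image-transpose-comm e f A)) (ef-clones A)

same-indep⇒ExtIsomorphic : ∀ {n} {N N′ : Matroid (suc n)} →
  (∀ X → Indep N X ⇔ Indep N′ X) → ExtIsomorphic N N′
same-indep⇒ExtIsomorphic {N = N} {N′} N⇔N′ =
  Perm.id , (λ X → subst (λ Y → Indep N X ⇔ Indep N′ Y) (sym (image-id X)) (N⇔N′ X)) , λ _ → refl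

-- Indepᴾ is the principal extension of M on the flat spanned by S: A ∪ {f} is independent
-- iff A is independent and S ⊈ cl(A).
module PrincipalExtension {n} (M : Matroid n) (S : Subset n) where

  IndepWithNew : Subset n → Set
  IndepWithNew A = ∃ λ s → s ∈ S × s ∉ A × Indep M (A ∪ ⁅ s ⁆)

  Indepᴾ : Subset (suc n) → Set
  Indepᴾ (false ∷ A) = Indep M A
  Indepᴾ (true  ∷ A) = IndepWithNew A

  indepᴾ? : ∀ X → Dec (Indepᴾ X)
  indepᴾ? (false ∷ A) = indep? M A
  indepᴾ? (true  ∷ A) = any? λ s → s ∈? S ×-dec ¬? (s ∈? A) ×-dec indep? M (A ∪ ⁅ s ⁆)

  indepᴾ-subset : ∀ {X Y} → X ⊆ Y → Indepᴾ Y → Indepᴾ X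
  indepᴾ-subset {false ∷ A} {false ∷ B} X⊆Y B-ind = indep-subset M (drop-∷-⊆ X⊆Y) B-ind
  indepᴾ-subset {false ∷ A} {true  ∷ B} X⊆Y (_ , _ , _ , Bs-ind) =
    indep-subset M (⊆-trans (drop-∷-⊆ X⊆Y) (p⊆p∪q _)) Bs-ind
  indepᴾ-subset {true  ∷ A} {false ∷ B} X⊆Y _ = contradiction (X⊆Y here) λ ()
  indepᴾ-subset {true  ∷ A} {true  ∷ B} X⊆Y (s , s∈S , s∉B , Bs-ind) =
    s , s∈S , s∉B ∘ drop-∷-⊆ X⊆Y ,
    indep-subset M (p∪⁅x⁆⊆q (⊆-trans (drop-∷-⊆ X⊆Y) (p⊆p∪q _)) y∈p∪⁅y⁆) Bs-ind

  extend-with-new : ∀ {A s x} → s ∈ S → s ∉ A → x ∉ A ∪ ⁅ s ⁆ →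
    Indep M ((A ∪ ⁅ s ⁆) ∪ ⁅ x ⁆) → IndepWithNew (A ∪ ⁅ x ⁆)
  extend-with-new {A} {s} {x} s∈S s∉A x∉As Asx-ind =
    s , s∈S , x∉p∪⁅y⁆ s∉A (λ s≡x → x∉As (subst (_∈ A ∪ ⁅ s ⁆) s≡x y∈p∪⁅y⁆)) ,
    subst (Indep M) (p∪⁅x⁆∪⁅y⁆-comm s x) Asx-ind

  -- A first augmentation inside M supplies y ∈ B, a second one, from (A ∪ {s}) ∪ {t}, an
  -- element z ∈ {s, t} ⊆ S witnessing that A ∪ {y, f} is independent.
  exchange-new : ∀ {A B s t} → s ∈ S → t ∈ S → s ∉ A → t ∉ A ∪ ⁅ s ⁆ →
    Indep M ((A ∪ ⁅ s ⁆) ∪ ⁅ t ⁆) → Indep M B → ∣ A ∣ < ∣ B ∣ →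
    ∃ λ y → y ∈ B × y ∉ A × IndepWithNew (A ∪ ⁅ y ⁆)
  exchange-new {A} {B} {s} {t} s∈S t∈S s∉A t∉As Ast-ind B-ind lt
    with indep-aug M (indep-subset M (⊆-trans (p⊆p∪q _) (p⊆p∪q _)) Ast-ind) B-ind lt
  ... | y , y∈B , y∉A , Ay-ind with indep-aug M Ay-ind Ast-ind sizes
    where
    sizes : ∣ A ∪ ⁅ y ⁆ ∣ < ∣ (A ∪ ⁅ s ⁆) ∪ ⁅ t ⁆ ∣
    sizes = subst₂ _<_ (sym (∣p∪⁅x⁆∣≡1+∣p∣ y∉A))
      (sym (trans (∣p∪⁅x⁆∣≡1+∣p∣ t∉As) (cong suc (∣p∪⁅x⁆∣≡1+∣p∣ s∉A)))) (n<1+n _)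
  ...   | z , z∈Ast , z∉Ay , Ayz-ind = y , y∈B , y∉A , z , z∈S , z∉Ay , Ayz-ind
    where
    z∈S : z ∈ S
    z∈S with x∈p∪⁅y⁆⁻ z∈Ast
    ... | inj₂ refl = t∈S
    ... | inj₁ z∈As with x∈p∪⁅y⁆⁻ z∈As
    ...   | inj₁ z∈A  = contradiction (p⊆p∪q _ z∈A) z∉Ay
    ...   | inj₂ refl = s∈S

  indepᴾ-aug : ∀ {X Y} → Indepᴾ X → Indepᴾ Y → ∣ X ∣ < ∣ Y ∣ →
    ∃ λ x → x ∈ Y × x ∉ X × Indepᴾ (X ∪ ⁅ x ⁆)
  indepᴾ-aug {false ∷ A} {false ∷ B} A-ind B-ind lt with indep-aug M A-ind B-ind lt
  ... | x , x∈B , x∉A , Ax-ind = suc x , there x∈B , x∉A ∘ drop-there , Ax-ind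
  indepᴾ-aug {false ∷ A} {true ∷ B} A-ind (t , t∈S , t∉B , Bt-ind) lt
    with indep-aug M A-ind Bt-ind (subst (∣ A ∣ <_) (sym (∣p∪⁅x⁆∣≡1+∣p∣ t∉B)) lt)
  ... | x , x∈Bt , x∉A , Ax-ind with x∈p∪⁅y⁆⁻ x∈Bt
  ...   | inj₁ x∈B  = suc x , there x∈B , x∉A ∘ drop-there , Ax-ind
  ...   | inj₂ refl =
    zero , here , (λ ()) , subst IndepWithNew (sym (∪-identityʳ A)) (x , t∈S , x∉A , Ax-ind)
  indepᴾ-aug {true ∷ A} {false ∷ B} (s , s∈S , s∉A , As-ind) B-ind lt
    with indep-aug M As-ind B-ind (subst (_< ∣ B ∣) (sym (∣p∪⁅x⁆∣≡1+∣p∣ s∉A)) lt)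
  ... | x , x∈B , x∉As , Asx-ind =
    suc x , there x∈B , x∉As ∘ p⊆p∪q _ ∘ drop-there , extend-with-new s∈S s∉A x∉As Asx-ind
  indepᴾ-aug {true ∷ A} {true ∷ B} (s , s∈S , s∉A , As-ind) (t , t∈S , t∉B , Bt-ind) lt
    with indep-aug M As-ind Bt-ind
           (subst₂ _<_ (sym (∣p∪⁅x⁆∣≡1+∣p∣ s∉A)) (sym (∣p∪⁅x⁆∣≡1+∣p∣ t∉B)) lt)
  ... | x , x∈Bt , x∉As , Asx-ind with x∈p∪⁅y⁆⁻ x∈Bt
  ...   | inj₁ x∈B  =
    suc x , there x∈B , x∉As ∘ p⊆p∪q _ ∘ drop-there , extend-with-new s∈S s∉A x∉As Asx-ind
  ...   | inj₂ refl
    with exchange-new s∈S t∈S s∉A x∉As Asx-ind (indep-subset M (p⊆p∪q _) Bt-ind) (≤-pred lt)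
  ...     | y , y∈B , y∉A , Ay-new = suc y , there y∈B , y∉A ∘ drop-there , Ay-new

  principalExtension : Matroid (suc n)
  principalExtension = record
    { Indep        = Indepᴾ
    ; indep?       = indepᴾ?
    ; indep-empty  = indep-empty M
    ; indep-subset = indepᴾ-subset
    ; indep-aug    = indepᴾ-aug
    }

  principalExtension-isExtension : IsExtension M principalExtension
  principalExtension-isExtension A = ⇔-id _

  module _ (S-clones : CloneSet M S) where

    swap-new-indep : ∀ {a} → a ∈ S → ∀ X → Indepᴾ X → Indepᴾ (image (transpose zero (suc a)) X)
    swap-new-indep {a} a∈S (false ∷ Y) Y-ind with a ∈? Y
    ... | no a∉Y = indepᴾ-subset {Y = false ∷ Y}
      (image-transpose₀-⊆ a (λ ()) (λ a∈X → contradiction (drop-there a∈X) a∉Y) (λ k∈X _ → k∈X))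
      Y-ind
    ... | yes a∈Y = indepᴾ-subset {Y = true ∷ (Y - a)}
      (image-transpose₀-⊆ a (λ ()) (λ _ → here)
        (λ k∈X k≢a → there (x∈p∧x≢y⇒x∈p-y (drop-there k∈X) k≢a)))
      (a , a∈S , x∉p-x Y a , indep-subset M (p∪⁅x⁆⊆q (p─q⊆p Y ⁅ a ⁆) a∈Y) Y-ind)
    swap-new-indep {a} a∈S (true ∷ Y) Y-new with a ∈? Y | Y-new
    ... | yes a∈Y | _ = indepᴾ-subset {Y = true ∷ Y}
      (image-transpose₀-⊆ a (λ _ → there a∈Y) (λ _ → here) (λ k∈X _ → k∈X)) Y-new
    ... | no a∉Y | s , s∈S , s∉Y , Ys-ind = indepᴾ-subset {Y = false ∷ (Y ∪ ⁅ a ⁆)}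
      (image-transpose₀-⊆ a (λ _ → there y∈p∪⁅y⁆) (λ a∈X → contradiction (drop-there a∈X) a∉Y)
        (λ k∈X _ → there (p⊆p∪q _ (drop-there k∈X))))
      (automorphism-transfer M (transpose a s) (Y ∪ ⁅ a ⁆) (S-clones a s a∈S s∈S)
        (image-transpose-∪⁅⁆-⊆ a∉Y s∉Y) Ys-ind)

    swap-old-indep : ∀ {a b} → a ∈ S → b ∈ S →
      ∀ X → Indepᴾ X → Indepᴾ (image (transpose (suc a) (suc b)) X)
    swap-old-indep {a} {b} a∈S b∈S (x ∷ Y) X-ind =
      subst Indepᴾ (sym (image-transpose-suc a b x Y)) (lifted x X-ind)
      where
      ρ = transpose a b
      ρ-aut = S-clones a b a∈S b∈S
      lifted : ∀ x → Indepᴾ (x ∷ Y) → Indepᴾ (x ∷ image ρ Y)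
      lifted false Y-ind = Equivalence.to (ρ-aut Y) Y-ind
      lifted true (s , s∈S , s∉Y , Ys-ind) =
        ρ ⟨$⟩ʳ s , transpose-∈ a∈S b∈S s∈S , ∉-image⁺ ρ s∉Y ,
        indep-subset M
          (p∪⁅x⁆⊆q {p = image ρ Y} (image-mono ρ {Y} (p⊆p∪q ⁅ s ⁆)) (∈-image⁺ ρ (y∈p∪⁅y⁆ {p = Y})))
          (Equivalence.to (ρ-aut (Y ∪ ⁅ s ⁆)) Ys-ind)

    principalExtension-clones : CloneSet principalExtension (true ∷ S)
    principalExtension-clones zero zero _ _ = clones-refl principalExtension zero
    principalExtension-clones zero (suc a) _ (there a∈S) =
      involution⇒automorphism principalExtension (transpose zero (suc a))
        (transpose-involutive zero (suc a)) (swap-new-indep a∈S)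
    principalExtension-clones (suc a) zero (there a∈S) _ =
      clones-sym principalExtension {zero} {suc a} (principalExtension-clones zero (suc a) here (there a∈S))
    principalExtension-clones (suc a) (suc b) (there a∈S) (there b∈S) =
      involution⇒automorphism principalExtension (transpose (suc a) (suc b))
        (transpose-involutive (suc a) (suc b)) (swap-old-indep a∈S b∈S)

  clone-extension-indep : ¬ Indep M S → ∀ N → IsCloneExtension M S N → ∀ X → Indep N X ⇔ Indepᴾ X
  clone-extension-indep S-dep _ (ext , _) (false ∷ A) = ⇔-sym (ext A)
  clone-extension-indep S-dep N (ext , N-clones) (true ∷ A) = mk⇔ to from
    where
    swap-with : ∀ {s} → s ∈ S → IsAutomorphism N (transpose zero (suc s))
    swap-with {s} s∈S = N-clones zero (suc s) here (there s∈S)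
    to : Indep N (true ∷ A) → IndepWithNew A
    to fA-ind with ⊈⇒∃∉ (λ S⊆A → S-dep (indep-subset M S⊆A A-ind))
      where
      A-ind : Indep M A
      A-ind = Equivalence.from (ext A) (indep-subset N (out⊆ ⊆-refl) fA-ind)
    ... | s , s∈S , s∉A = s , s∈S , s∉A , Equivalence.from (ext (A ∪ ⁅ s ⁆))
      (automorphism-transfer N (transpose zero (suc s)) (false ∷ (A ∪ ⁅ s ⁆)) (swap-with s∈S)
        (image-transpose₀-⊆ s (λ ()) (λ _ → here)
          (λ k∈X k≢s → there (x∈p∪⁅y⁆∧x≢y⇒x∈p (drop-there k∈X) k≢s)))
        fA-ind)
    from : IndepWithNew A → Indep N (true ∷ A)
    from (s , s∈S , s∉A , As-ind) = automorphism-transfer N (transpose zero (suc s)) (true ∷ A) (swap-with s∈S)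
      (image-transpose₀-⊆ s (λ _ → there y∈p∪⁅y⁆) (λ s∈X → contradiction (drop-there s∈X) s∉A)
        (λ k∈X _ → there (p⊆p∪q _ (drop-there k∈X))))
      (Equivalence.to (ext (A ∪ ⁅ s ⁆)) As-ind)

lemma7 : ∀ {n} (M : Matroid n) (S : Subset n) → CloneSet M S → Circuit M S →
    Σ (Matroid (suc n)) (IsCloneExtension M S)
    × (∀ (N N′ : Matroid (suc n)) → IsCloneExtension M S N → IsCloneExtension M S N′ → ExtIsomorphic N N′)
lemma7 M S S-clones S-circuit =
  (principalExtension , principalExtension-isExtension , principalExtension-clones S-clones) ,
  λ N N′ N-clone-ext N′-clone-ext → same-indep⇒ExtIsomorphic {N = N} {N′} λ X →
    ⇔-sym (clone-extension-indep S-dep N′ N′-clone-ext X) ⇔-∘ clone-extension-indep S-dep N N-clone-ext X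
  where
  open PrincipalExtension M S
  S-dep : ¬ Indep M S
  S-dep = proj₁ S-circuit
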